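{- Let $r,s,l$ be integers with $r,s,l \geq 2$. Then there exist an integer $n > l$ and a hypergraph $\mathcal{F}$ with vertex set $[n]$ such that $\chi\left(\mathrm{KG}^r(\mathcal{F}_{s\text{ -stable}})\right) = 1$ and $\left\lceil \frac{\mathrm{cd}^s(\mathcal{F})}{r-1} \right\rceil \geq 2$.
   Context: $[n]=\{1,\dots,n\}$. A hypergraph $\mathcal{H}$ on vertex set $V$ is a family $E(\mathcal{H})$ of nonempty subsets of $V$ (hyperedges). A set $S \subseteq [n]$ is $s$-stable if any two distinct $i,j \in S$ satisfy $s \leq |i-j| \leq n-s$. For a hypergraph $\mathcal{H}$ on $[n]$, $\mathcal{H}_{s\text{ -stable}}$ denotes the hypergraph on $[n]$ whose hyperedges are the $s$-stable hyperedges of $\mathcal{H}$. For a hypergraph $\mathcal{F}$ and $r\ge 2$, the general Kneser hypergraph $\mathrm{KG}^r(\mathcal{F})$ has vertex set $E(\mathcal{F})$, and its hyperedges are the sets of $r$ pairwise disjoint hyperedges of $\mathcal{F}$. The chromatic number $\chi$ of a hypergraph is the least number of colors in a vertex coloring with no monochromatic hyperedge (it is $0$ when the vertex set is empty). For $t\ge 2$, the $t$-colorability defect $\mathrm{cd}^t(\mathcal{H})$ is the minimum size of a set $S \subseteq V(\mathcal{H})$ such that the induced subhypergraph on $V(\mathcal{H})\setminus S$ (whose hyperedges are the hyperedges of $\mathcal{H}$ contained in $V(\mathcal{H})\setminus S$) admits a vertex coloring with at most $t$ colors having no monochromatic hyperedge. -}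

module Defs where

open import Data.Nat using (ℕ; zero; suc; _+_; _∸_; _≤_; _<_; s≤s; z≤n; NonZero; ∣_-_∣)
open import Data.Nat.DivMod using (_/_)
open import Data.Fin using (Fin; toℕ)
open import Data.Fin.Subset using (Subset; _∈_; _∉_; Nonempty; ∣_∣)
open import Data.Bool using (Bool; T)
open import Data.Product using (Σ; ∃; _×_; _,_; proj₁)
open import Relation.Nullary using (¬_)
open import Relation.Binary.PropositionalEquality using (_≡_; _≢_)

-- A hypergraph on [n] (vertices represented by Fin n, i.e. 0..n-1;
-- the stability condition only depends on differences, so this is a
-- faithful relabelling of [n] = {1..n}).
record Hypergraph (n : ℕ) : Set where
  field
    edge     : Subset n → Bool
    nonempty : ∀ e → T (edge e) → Nonempty e
open Hypergraph public

Stable : {n : ℕ} → ℕ → Subset n → Set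
Stable {n} s S = ∀ (i j : Fin n) → i ∈ S → j ∈ S → i ≢ j →
  (s ≤ ∣ toℕ i - toℕ j ∣) × (∣ toℕ i - toℕ j ∣ ≤ n ∸ s)

IsStableEdge : {n : ℕ} → ℕ → Hypergraph n → Subset n → Set
IsStableEdge s F e = T (edge F e) × Stable s e

Disjoint : {n : ℕ} → Subset n → Subset n → Set
Disjoint {n} a b = ∀ (i : Fin n) → i ∈ a → i ∉ b

KGVertex : {n : ℕ} → ℕ → Hypergraph n → Set
KGVertex s F = Σ (Subset _) (IsStableEdge s F)

-- hyperedges: r pairwise disjoint hyperedges of F_{s-stable}
-- (given as an r-tuple; pairwise disjoint nonempty sets are distinct)
KGEdge : {n : ℕ} → (r s : ℕ) → (F : Hypergraph n) → (Fin r → KGVertex s F) → Set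
KGEdge r s F t = ∀ (a b : Fin r) → a ≢ b →
  Disjoint (proj₁ (t a)) (proj₁ (t b))

KGProperColouring : {n : ℕ} → (r s : ℕ) → (F : Hypergraph n) → (k : ℕ) → (KGVertex s F → Fin k) → Set
KGProperColouring r s F k c = ∀ (t : Fin r → KGVertex s F) → KGEdge r s F t →
  ¬ (∃ λ (a : Fin k) → ∀ (i : Fin r) → c (t i) ≡ a)

KGColourable : {n : ℕ} → (r s : ℕ) → (F : Hypergraph n) → ℕ → Set
KGColourable r s F k = Σ (KGVertex s F → Fin k) (KGProperColouring r s F k)

KGChromaticNumberIs : {n : ℕ} → ℕ → ℕ → Hypergraph n → ℕ → Set
KGChromaticNumberIs r s F k =
  KGColourable r s F k × (∀ k′ → k′ < k → ¬ KGColourable r s F k′)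

-- a t-colouring of the induced subhypergraph on [n] \ S with no
-- monochromatic hyperedge (hyperedges of F contained in [n] \ S)
InducedColourable : {n : ℕ} → ℕ → Hypergraph n → Subset n → Set
InducedColourable {n} t F S =
  Σ ((i : Fin n) → i ∉ S → Fin t) λ c →
    ∀ (e : Subset n) → T (edge F e) → (sub : ∀ i → i ∈ e → i ∉ S) →
      ¬ (∃ λ (a : Fin t) → ∀ (i : Fin n) (h : i ∈ e) → c i (sub i h) ≡ a)

ColourabilityDefectIs : {n : ℕ} → ℕ → Hypergraph n → ℕ → Set
ColourabilityDefectIs {n} t F d =
  (∃ λ (S : Subset n) → ∣ S ∣ ≡ d × InducedColourable t F S) ×
  (∀ (S : Subset n) → InducedColourable t F S → d ≤ ∣ S ∣)

⌈_/_⌉ : ℕ → (k : ℕ) → .{{NonZero k}} → ℕ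
⌈ m / k ⌉ = (m + (k ∸ 1)) / k

pred-nonZero : (r : ℕ) → 2 ≤ r → NonZero (r ∸ 1)
pred-nonZero (suc (suc r)) (s≤s (s≤s _)) = _

-- Put n = (2r − 1)·g with g = (l + 1)·s, and on the cycle ℤ_n let A_j (j < 2r − 1) be the
-- arc of multiples of s from j·g to (j + 1)·g. F has these arcs and all pairs that are not
-- s-stable. The arcs are the only s-stable edges, and consecutive arcs share an end, so
-- r pairwise disjoint arcs would need 2r distinct ends among 2r − 1: KG^r(F_{s-stable}) is
-- edgeless with nonempty vertex set, hence χ = 1. Colouring by residue mod s handles the
-- pairs, and the ends 0, 2g, …, 2(r − 1)g meet every arc, so cd^s(F) ≤ r. Conversely, in an
-- s-colouring avoiding S, any s + 1 consecutive points p, …, p + s are pairwise unstable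
-- except p and p + s, which therefore share a colour; so an arc whose interval avoids S is
-- monochromatic. Thus S meets all 2r − 1 intervals [j·g, (j + 1)·g] of an odd cycle, whence
-- |S| ≥ r. Hence cd^s(F) = r and ⌈r / (r − 1)⌉ = 2.

module Submission where

open import Defs
open import Data.Nat
  using (ℕ; zero; suc; _+_; _*_; _∸_; _≤_; _<_; _≤?_; _<?_; z≤n; s≤s; s≤s⁻¹; NonZero; ≢-nonZero; >-nonZero⁻¹; ∣_-_∣)
open import Data.Nat.Properties
open import Data.Nat.Divisibility using (_∣_; divides; ∣⇒≤; ∣m+n∣m⇒∣n; n∣m⇒m%n≡0)
open import Data.Nat.DivMod
  using (_/_; _%_; _mod_; m≡m%n+[m/n]*n; m*n/n≡m; /-monoˡ-≤; m<n⇒m%n≡m; n%n≡0; m%n*o≡m*o%[n*o]; m%n%n≡m%n)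
open import Data.Fin as Fin using (Fin; zero; suc; toℕ; fromℕ; fromℕ<; splitAt; join)
open import Data.Fin.Properties
  using (toℕ-injective; toℕ<n; toℕ≤pred[n]; toℕ-fromℕ; toℕ-fromℕ<; pigeonhole; join-splitAt; any?)
import Data.Fin.Properties as Finₚ
open import Data.Fin.Subset using (Subset; _∈_; _∉_; _⊆_; ⁅_⁆; _∪_; ⊥; ∣_∣; Nonempty; inside; outside)
open import Data.Fin.Subset.Properties
  using (_∈?_; ∉⊥; ∣⊥∣≡0; x∈⁅x⁆; x∈⁅y⁆⇒x≡y; x∈p∪q⁺; x∈p∪q⁻; ∪-identityˡ; ∣p∣≤∣x∷p∣; p⊆q⇒∣p∣≤∣q∣)
open import Data.Vec using (_∷_; here; there)
open import Data.Vec.Properties using (≡-dec)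
open import Data.Bool using (T)
open import Data.Bool.Properties using () renaming (_≟_ to _≟ᵇ_)
open import Data.Product using (Σ; ∃; _×_; _,_; proj₁; proj₂)
open import Data.Sum using (_⊎_; inj₁; inj₂; [_,_]; reduce)
open import Data.Empty using () renaming (⊥ to Empty)
open import Function using (_∘_)
open import Function.Definitions using (Injective)
open import Relation.Binary.Core using (_Preserves_⟶_)
open import Relation.Binary.Definitions using (Decidable; tri<; tri≈; tri>)
open import Relation.Binary.PropositionalEquality
  using (_≡_; _≢_; refl; sym; trans; cong; cong₂; subst; subst₂; module ≡-Reasoning)
open import Relation.Nullary using (¬_; Dec; yes; no; contradiction)
open import Relation.Nullary.Decidable using (⌊_⌋; _×-dec_; _⊎-dec_; ¬?; toWitness; fromWitness; recompute)

image : ∀ {k n} → (Fin k → Fin n) → Subset n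
image {zero}  f = ⊥
image {suc k} f = ⁅ f zero ⁆ ∪ image (f ∘ suc)

∈-image⁺ : ∀ {k n} (f : Fin k → Fin n) (i : Fin k) → f i ∈ image f
∈-image⁺ f zero    = x∈p∪q⁺ (inj₁ (x∈⁅x⁆ (f zero)))
∈-image⁺ f (suc i) = x∈p∪q⁺ (inj₂ (∈-image⁺ (f ∘ suc) i))

∈-image⁻ : ∀ {k n} (f : Fin k → Fin n) {x : Fin n} → x ∈ image f → ∃ λ i → x ≡ f i
∈-image⁻ {zero}  f x∈ = contradiction x∈ ∉⊥
∈-image⁻ {suc k} f x∈ with x∈p∪q⁻ ⁅ f zero ⁆ (image (f ∘ suc)) x∈
... | inj₁ x∈⁅f0⁆ = zero , x∈⁅y⁆⇒x≡y (f zero) x∈⁅f0⁆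
... | inj₂ x∈rest with ∈-image⁻ (f ∘ suc) x∈rest
...   | i , x≡fsi = suc i , x≡fsi

∣⁅x⁆∪p∣≤1+∣p∣ : ∀ {n} (x : Fin n) (p : Subset n) → ∣ ⁅ x ⁆ ∪ p ∣ ≤ suc ∣ p ∣
∣⁅x⁆∪p∣≤1+∣p∣ zero    (b ∷ p)       rewrite ∪-identityˡ p = s≤s (∣p∣≤∣x∷p∣ b p)
∣⁅x⁆∪p∣≤1+∣p∣ (suc x) (inside ∷ p)  = s≤s (∣⁅x⁆∪p∣≤1+∣p∣ x p)
∣⁅x⁆∪p∣≤1+∣p∣ (suc x) (outside ∷ p) = ∣⁅x⁆∪p∣≤1+∣p∣ x p

x∉p⇒∣⁅x⁆∪p∣≡1+∣p∣ : ∀ {n} {x : Fin n} {p : Subset n} → x ∉ p → ∣ ⁅ x ⁆ ∪ p ∣ ≡ suc ∣ p ∣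
x∉p⇒∣⁅x⁆∪p∣≡1+∣p∣ {x = zero}  {inside  ∷ p} x∉p = contradiction here x∉p
x∉p⇒∣⁅x⁆∪p∣≡1+∣p∣ {x = zero}  {outside ∷ p} x∉p = cong (suc ∘ ∣_∣) (∪-identityˡ p)
x∉p⇒∣⁅x⁆∪p∣≡1+∣p∣ {x = suc x} {inside  ∷ p} x∉p = cong suc (x∉p⇒∣⁅x⁆∪p∣≡1+∣p∣ (x∉p ∘ there))
x∉p⇒∣⁅x⁆∪p∣≡1+∣p∣ {x = suc x} {outside ∷ p} x∉p = x∉p⇒∣⁅x⁆∪p∣≡1+∣p∣ (x∉p ∘ there)

∣image∣≤ : ∀ {k n} (f : Fin k → Fin n) → ∣ image f ∣ ≤ k
∣image∣≤ {zero}  {n} f = ≤-reflexive (∣⊥∣≡0 n)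
∣image∣≤ {suc k} f = ≤-trans (∣⁅x⁆∪p∣≤1+∣p∣ (f zero) (image (f ∘ suc))) (s≤s (∣image∣≤ (f ∘ suc)))

injective⇒∣image∣≡ : ∀ {k n} (f : Fin k → Fin n) → Injective _≡_ _≡_ f → ∣ image f ∣ ≡ k
injective⇒∣image∣≡ {zero}  {n} f _ = ∣⊥∣≡0 n
injective⇒∣image∣≡ {suc k} f f-inj = begin
  ∣ ⁅ f zero ⁆ ∪ image (f ∘ suc) ∣ ≡⟨ x∉p⇒∣⁅x⁆∪p∣≡1+∣p∣ f0∉rest ⟩
  suc ∣ image (f ∘ suc) ∣          ≡⟨ cong suc (injective⇒∣image∣≡ (f ∘ suc) (Finₚ.suc-injective ∘ f-inj)) ⟩
  suc k                            ∎
  where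
  open ≡-Reasoning
  f0∉rest : f zero ∉ image (f ∘ suc)
  f0∉rest f0∈ with ∈-image⁻ (f ∘ suc) f0∈
  ... | i , f0≡fsi with f-inj f0≡fsi
  ... | ()

injective⇒≤∣∣ : ∀ {k n} (f : Fin k → Fin n) {S : Subset n} →
  Injective _≡_ _≡_ f → (∀ i → f i ∈ S) → k ≤ ∣ S ∣
injective⇒≤∣∣ f f-inj f∈S = begin
  _           ≡⟨ injective⇒∣image∣≡ f f-inj ⟨
  ∣ image f ∣ ≤⟨ p⊆q⇒∣p∣≤∣q∣ image⊆S ⟩
  _           ∎
  where
  open ≤-Reasoning
  image⊆S : image f ⊆ _
  image⊆S x∈ with ∈-image⁻ f x∈
  ... | i , refl = f∈S i

strictlyMonotone⇒injective : ∀ {k} (f : Fin k → ℕ) → f Preserves Fin._<_ ⟶ _<_ → Injective _≡_ _≡_ f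
strictlyMonotone⇒injective f f-mono {a} {b} fa≡fb with Finₚ.<-cmp a b
... | tri< a<b _ _ = contradiction fa≡fb (<⇒≢ (f-mono a<b))
... | tri≈ _ a≡b _ = a≡b
... | tri> _ _ b<a = contradiction (sym fa≡fb) (<⇒≢ (f-mono b<a))

2≤⌈m/n⌉ : ∀ {m} n .{{_ : NonZero n}} → n < m → 2 ≤ ⌈ m / n ⌉
2≤⌈m/n⌉ {m} n@(suc k) n<m = begin
  2               ≡⟨ m*n/n≡m 2 n ⟨
  2 * n / n       ≤⟨ /-monoˡ-≤ n 2n≤m+k ⟩
  (m + k) / n     ∎
  where
  open ≤-Reasoning
  2n≤m+k : 2 * n ≤ m + k
  2n≤m+k = begin
    2 * n         ≡⟨ cong (n +_) (+-identityʳ n) ⟩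
    n + n         ≡⟨ +-suc n k ⟩
    suc n + k     ≤⟨ +-monoˡ-≤ k n<m ⟩
    m + k         ∎

m%d≡n%d⇒d∣∣m-n∣ : ∀ {m n} d .{{_ : NonZero d}} → m % d ≡ n % d → d ∣ ∣ m - n ∣
m%d≡n%d⇒d∣∣m-n∣ {m} {n} d m%d≡n%d = divides ∣ m / d - n / d ∣ (begin
  ∣ m - n ∣                                  ≡⟨ cong₂ ∣_-_∣ (m≡m%n+[m/n]*n m d) n≡ ⟩
  ∣ m % d + m / d * d - m % d + n / d * d ∣  ≡⟨ ∣m+n-m+o∣≡∣n-o∣ (m % d) _ _ ⟩
  ∣ m / d * d - n / d * d ∣                  ≡⟨ *-distribʳ-∣-∣ d (m / d) (n / d) ⟨
  ∣ m / d - n / d ∣ * d                      ∎)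
  where
  open ≡-Reasoning
  n≡ : n ≡ m % d + n / d * d
  n≡ = trans (m≡m%n+[m/n]*n n d) (cong (_+ n / d * d) (sym m%d≡n%d))

toℕ-mod : ∀ x n .{{_ : NonZero n}} → toℕ (x mod n) ≡ x % n
toℕ-mod x n = toℕ-fromℕ< _

toℕ-mod-< : ∀ {x n} .{{_ : NonZero n}} → x < n → toℕ (x mod n) ≡ x
toℕ-mod-< {x} {n} x<n = trans (toℕ-mod x n) (m<n⇒m%n≡m x<n)

n-mod-n≡0-mod-n : ∀ n .{{_ : NonZero n}} → n mod n ≡ 0 mod n
n-mod-n≡0-mod-n n = toℕ-injective (begin
  toℕ (n mod n) ≡⟨ toℕ-mod n n ⟩
  n % n         ≡⟨ n%n≡0 n ⟩
  0             ≡⟨ toℕ-mod-< (>-nonZero⁻¹ n) ⟨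
  toℕ (0 mod n) ∎)
  where open ≡-Reasoning

mod-injective : ∀ {x y n} .{{_ : NonZero n}} → x < n → y < n → x mod n ≡ y mod n → x ≡ y
mod-injective x<n y<n eq = trans (sym (toℕ-mod-< x<n)) (trans (cong toℕ eq) (toℕ-mod-< y<n))

increasing-positions⇒≤∣∣ : ∀ {k n} .{{_ : NonZero n}} {S : Subset n} (P : Fin k → ℕ) →
  P Preserves Fin._<_ ⟶ _<_ → (∀ a → P a < n) → (∀ a → P a mod n ∈ S) → k ≤ ∣ S ∣
increasing-positions⇒≤∣∣ {n = n} P P-mono P<n P∈S = injective⇒≤∣∣ (λ a → P a mod n) injective P∈S
  where
  injective : Injective _≡_ _≡_ (λ a → P a mod n)
  injective eq = strictlyMonotone⇒injective P P-mono (mod-injective (P<n _) (P<n _) eq)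

StablePair : ∀ {n} → ℕ → Fin n → Fin n → Set
StablePair {n} s u w = s ≤ ∣ toℕ u - toℕ w ∣ × ∣ toℕ u - toℕ w ∣ ≤ n ∸ s

stablePair? : ∀ {n} s → Decidable (StablePair {n} s)
stablePair? {n} s u w = (s ≤? ∣ toℕ u - toℕ w ∣) ×-dec (∣ toℕ u - toℕ w ∣ ≤? n ∸ s)

∣distance⇒stablePair : ∀ {n s} {u w : Fin n} → s ∣ n → u ≢ w → s ∣ ∣ toℕ u - toℕ w ∣ → StablePair s u w
∣distance⇒stablePair {n} {s} {u} {w} s∣n u≢w s∣d =
  ∣⇒≤ {{≢-nonZero d≢0}} s∣d ,
  subst (_≤ n ∸ s) (m∸[m∸n]≡n (<⇒≤ d<n)) (∸-monoʳ-≤ n (∣⇒≤ {{≢-nonZero (m>n⇒m∸n≢0 d<n)}} s∣n∸d))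
  where
  d : ℕ
  d = ∣ toℕ u - toℕ w ∣
  d≢0 : d ≢ 0
  d≢0 = u≢w ∘ toℕ-injective ∘ ∣m-n∣≡0⇒m≡n
  d<n : d < n
  d<n = ≤-<-trans (∣m-n∣≤m⊔n (toℕ u) (toℕ w)) (⊔-lub (toℕ<n u) (toℕ<n w))
  s∣n∸d : s ∣ n ∸ d
  s∣n∸d = ∣m+n∣m⇒∣n (subst (s ∣_) (sym (m+[n∸m]≡n (<⇒≤ d<n))) s∣n) s∣d

close⇒unstable : ∀ {n s x y} .{{_ : NonZero n}} → s ≤ n → x < y → y ≤ n → y ∸ x < s →
  x mod n ≢ y mod n × ¬ StablePair s (x mod n) (y mod n)
close⇒unstable {n} {s} {x} {y} s≤n x<y y≤n y∸x<s with m≤n⇒m<n∨m≡n y≤n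
... | inj₁ y<n =
  (λ eq → <⇒≢ x<y (mod-injective x<n y<n eq)) , λ (s≤d , _) → <⇒≱ y∸x<s (subst (s ≤_) d≡y∸x s≤d)
  where
  x<n : x < n
  x<n = <-trans x<y y<n
  d≡y∸x : ∣ toℕ (x mod n) - toℕ (y mod n) ∣ ≡ y ∸ x
  d≡y∸x = trans (cong₂ ∣_-_∣ (toℕ-mod-< x<n) (toℕ-mod-< y<n)) (m≤n⇒∣m-n∣≡n∸m (<⇒≤ x<y))
... | inj₂ refl =
  (λ eq → <⇒≢ 0<x (sym (mod-injective x<n (>-nonZero⁻¹ n) (trans eq (n-mod-n≡0-mod-n n))))) ,
  λ (_ , d≤n∸s) → <⇒≱ n∸s<x (subst (_≤ n ∸ s) d≡x d≤n∸s)
  where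
  x<n : x < n
  x<n = x<y
  n∸s<x : n ∸ s < x
  n∸s<x = subst (n ∸ s <_) (m∸[m∸n]≡n (<⇒≤ x<n)) (∸-monoʳ-< y∸x<s s≤n)
  0<x : 0 < x
  0<x = ≤-<-trans z≤n n∸s<x
  d≡x : ∣ toℕ (x mod n) - toℕ (n mod n) ∣ ≡ x
  d≡x = begin
    ∣ toℕ (x mod n) - toℕ (n mod n) ∣ ≡⟨ cong₂ ∣_-_∣ (toℕ-mod-< x<n) (cong toℕ (n-mod-n≡0-mod-n n)) ⟩
    ∣ x - toℕ (0 mod n) ∣              ≡⟨ cong (∣ x -_∣) (toℕ-mod-< (>-nonZero⁻¹ n)) ⟩
    ∣ x - 0 ∣                          ≡⟨ ∣-∣-identityʳ x ⟩
    x                                  ∎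
    where open ≡-Reasoning

cycle-disjoint-bound : ∀ {m n k} (A : Fin m → Subset n) (corner : Fin m → Fin n) (next : Fin m → Fin m) →
  (∀ j → next j ≢ j) → (∀ j → corner j ∈ A j) → (∀ j → corner (next j) ∈ A j) →
  (J : Fin k → Fin m) → (∀ a b → a ≢ b → Disjoint (A (J a)) (A (J b))) → k + k ≤ m
cycle-disjoint-bound {m} {n} {k} A corner next next≢id corner∈ next-corner∈ J disjoint =
  ≮⇒≥ λ m<k+k → let (i , i′ , i<i′ , same) = pigeonhole m<k+k (side ∘ splitAt k) in
    collide (splitAt k i) (splitAt k i′) (Finₚ.<⇒≢ i<i′ ∘ splitAt-injective) same
  where
  side : Fin k ⊎ Fin k → Fin m
  side = [ J , next ∘ J ]
  corner-side∈ : ∀ x → corner (side x) ∈ A (J (reduce x))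
  corner-side∈ (inj₁ a) = corner∈ (J a)
  corner-side∈ (inj₂ a) = next-corner∈ (J a)
  splitAt-injective : ∀ {i i′} → splitAt k i ≡ splitAt k i′ → i ≡ i′
  splitAt-injective {i} {i′} eq =
    trans (sym (join-splitAt k k i)) (trans (cong (join k k) eq) (join-splitAt k k i′))
  sameOwner : ∀ x y → x ≢ y → side x ≡ side y → reduce x ≡ reduce y → Empty
  sameOwner (inj₁ a) (inj₁ .a) x≢y _    refl = x≢y refl
  sameOwner (inj₂ a) (inj₂ .a) x≢y _    refl = x≢y refl
  sameOwner (inj₁ a) (inj₂ .a) _   same refl = next≢id (J a) (sym same)
  sameOwner (inj₂ a) (inj₁ .a) _   same refl = next≢id (J a) same
  collide : ∀ x y → x ≢ y → side x ≡ side y → Empty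
  collide x y x≢y same with reduce x Fin.≟ reduce y
  ... | yes owners≡ = sameOwner x y x≢y same owners≡
  ... | no  owners≢ = disjoint (reduce x) (reduce y) owners≢ (corner (side x)) (corner-side∈ x)
                        (subst (λ j → corner j ∈ A (J (reduce y))) (sym same) (corner-side∈ y))

far-apart⇒extremes : ∀ {i k s} → i < k → k ≤ s → s ≤ k ∸ i → i ≡ 0 × k ≡ s
far-apart⇒extremes {zero}          _         k≤s s≤k   = refl , ≤-antisym k≤s s≤k
far-apart⇒extremes {suc i} {suc k} (s≤s i<k) k<s s≤k∸i = contradiction (≤-trans s≤k∸i (m∸n≤m k i)) (<⇒≱ k<s)

even-or-odd : ∀ j → ∃ λ a → j ≡ a + a ⊎ j ≡ suc (a + a)
even-or-odd zero = 0 , inj₁ refl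
even-or-odd (suc j) with even-or-odd j
... | a , inj₁ j≡a+a = a , inj₂ (cong suc j≡a+a)
... | a , inj₂ j≡1+a+a = suc a , inj₁ (trans (cong suc j≡1+a+a) (cong suc (sym (+-suc a a))))

a+a<b+b⇒a<b : ∀ {a b} → a + a < b + b → a < b
a+a<b+b⇒a<b a+a<b+b = ≰⇒> λ b≤a → <⇒≱ a+a<b+b (+-mono-≤ b≤a b≤a)

a<b⇒1+a+a<b+b : ∀ {a b} → a < b → suc (a + a) < b + b
a<b⇒1+a+a<b+b {a} {b} a<b = subst (_≤ b + b) (cong suc (+-suc a a)) (+-mono-≤ a<b a<b)

module Construction (s L q : ℕ) .{{_ : NonZero s}} .{{_ : NonZero L}} .{{_ : NonZero q}} where

  r m g n : ℕ
  r = suc q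
  m = suc (q + q)
  g = L * s
  n = m * g

  instance
    g-nonZero : NonZero g
    g-nonZero = m*n≢0 L s
    n-nonZero : NonZero n
    n-nonZero = m*n≢0 m g

  0<q+q : 0 < q + q
  0<q+q = <-≤-trans (>-nonZero⁻¹ q) (m≤m+n q q)

  g<n : g < n
  g<n = m<m+n g (*-monoˡ-< g 0<q+q)

  s≤n : s ≤ n
  s≤n = ≤-trans (m≤n*m s L) (<⇒≤ g<n)

  L≤n : L ≤ n
  L≤n = ≤-trans (m≤m*n L s) (<⇒≤ g<n)

  s∣n : s ∣ n
  s∣n = divides (m * L) (sym (*-assoc m L s))

  m<r+r : m < r + r
  m<r+r = s≤s (+-monoʳ-< q (n<1+n q))

  -- Position x of the cycle is the vertex x mod n; position n is vertex 0 and closes the last arc.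
  arc-point : ℕ → Fin (suc L) → Fin n
  arc-point j t = (toℕ t * s + j * g) mod n

  arc : ℕ → Subset n
  arc j = image (arc-point j)

  start∈arc : ∀ j → (j * g) mod n ∈ arc j
  start∈arc j = ∈-image⁺ (arc-point j) zero

  end∈arc : ∀ j → (suc j * g) mod n ∈ arc j
  end∈arc j =
    subst (λ t → (t * s + j * g) mod n ∈ arc j) (toℕ-fromℕ L) (∈-image⁺ (arc-point j) (fromℕ L))

  IsPairEdge : Subset n → Set
  IsPairEdge e = ∃ λ u → ∃ λ w → u ≢ w × ¬ StablePair s u w × e ≡ ⁅ u ⁆ ∪ ⁅ w ⁆

  IsArc : Subset n → Set
  IsArc e = ∃ λ (j : Fin m) → e ≡ arc (toℕ j)

  IsEdge : Subset n → Set
  IsEdge e = IsPairEdge e ⊎ IsArc e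

  isEdge? : ∀ e → Dec (IsEdge e)
  isEdge? e =
    (any? λ u → any? λ w → ¬? (u Fin.≟ w) ×-dec ¬? (stablePair? s u w) ×-dec ≡-dec _≟ᵇ_ e (⁅ u ⁆ ∪ ⁅ w ⁆))
    ⊎-dec (any? λ j → ≡-dec _≟ᵇ_ e (arc (toℕ j)))

  edge-nonempty : ∀ {e} → IsEdge e → Nonempty e
  edge-nonempty (inj₁ (u , _ , _ , _ , refl)) = u , x∈p∪q⁺ (inj₁ (x∈⁅x⁆ u))
  edge-nonempty (inj₂ (j , refl))             = _ , start∈arc (toℕ j)

  F : Hypergraph n
  F = record
    { edge     = λ e → ⌊ isEdge? e ⌋
    ; nonempty = λ e e∈F → edge-nonempty (toWitness {a? = isEdge? e} e∈F)
    }

  arc∈F : ∀ (j : Fin m) → T (edge F (arc (toℕ j)))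
  arc∈F j = fromWitness (inj₂ (j , refl))

  stableEdge⇒arc : ∀ {e} → IsStableEdge s F e → IsArc e
  stableEdge⇒arc {e} (e∈F , e-stable) with toWitness {a? = isEdge? e} e∈F
  ... | inj₂ e-arc = e-arc
  ... | inj₁ (u , w , u≢w , unstable , refl) =
    contradiction (e-stable u w (x∈p∪q⁺ (inj₁ (x∈⁅x⁆ u))) (x∈p∪q⁺ (inj₂ (x∈⁅x⁆ w))) u≢w) unstable

  offset≤g : ∀ (t : Fin (suc L)) → toℕ t * s ≤ g
  offset≤g t = *-monoˡ-≤ s (toℕ≤pred[n] t)

  arc₀-stable : Stable s (arc 0)
  arc₀-stable u w u∈ w∈ u≢w with ∈-image⁻ (arc-point 0) u∈ | ∈-image⁻ (arc-point 0) w∈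
  ... | t , refl | t′ , refl =
    ∣distance⇒stablePair s∣n u≢w (m%d≡n%d⇒d∣∣m-n∣ s (trans (multiple t) (sym (multiple t′))))
    where
    multiple : ∀ t → toℕ (arc-point 0 t) % s ≡ 0
    multiple t = trans (cong (_% s) (toℕ-mod-< point<n)) (n∣m⇒m%n≡0 _ s (divides (toℕ t) (+-identityʳ _)))
      where
      point<n : toℕ t * s + 0 < n
      point<n = ≤-<-trans (≤-trans (≤-reflexive (+-identityʳ _)) (offset≤g t)) g<n

  arc₀ : KGVertex s F
  arc₀ = arc 0 , arc∈F zero , arc₀-stable

  corner : Fin m → Fin n
  corner j = (toℕ j * g) mod n

  next : Fin m → Fin m
  next j = suc (toℕ j) mod m

  next≢id : ∀ j → next j ≢ j
  next≢id j next≡j with m≤n⇒m<n∨m≡n (toℕ<n j)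
  ... | inj₁ 1+j<m = 1+n≢n (trans (sym (toℕ-mod-< 1+j<m)) (cong toℕ next≡j))
  ... | inj₂ 1+j≡m = <⇒≢ (s≤s 0<q+q) (trans (cong suc (sym j≡0)) 1+j≡m)
    where
    j≡0 : toℕ j ≡ 0
    j≡0 = begin
      toℕ j               ≡⟨ cong toℕ next≡j ⟨
      toℕ (next j)        ≡⟨ toℕ-mod (suc (toℕ j)) m ⟩
      suc (toℕ j) % m     ≡⟨ cong (_% m) 1+j≡m ⟩
      m % m               ≡⟨ n%n≡0 m ⟩
      0                   ∎
      where open ≡-Reasoning

  corner-next≡end : ∀ j → corner (next j) ≡ (suc (toℕ j) * g) mod n
  corner-next≡end j = toℕ-injective (begin
    toℕ ((toℕ (next j) * g) mod n)  ≡⟨ toℕ-mod _ n ⟩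
    toℕ (next j) * g % n            ≡⟨ cong (λ x → x * g % n) (toℕ-mod (suc (toℕ j)) m) ⟩
    suc (toℕ j) % m * g % n         ≡⟨ cong (_% n) (m%n*o≡m*o%[n*o] (suc (toℕ j)) m g) ⟩
    suc (toℕ j) * g % n % n         ≡⟨ m%n%n≡m%n _ n ⟩
    suc (toℕ j) * g % n             ≡⟨ toℕ-mod _ n ⟨
    toℕ ((suc (toℕ j) * g) mod n)   ∎)
    where open ≡-Reasoning

  kg-edgeless : ∀ (t : Fin r → KGVertex s F) → ¬ KGEdge r s F t
  kg-edgeless t disjoint =
    <⇒≱ m<r+r (cycle-disjoint-bound (arc ∘ toℕ) corner next next≢id (start∈arc ∘ toℕ) next-corner∈
                 J arcs-disjoint)
    where
    J : Fin r → Fin m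
    J a = proj₁ (stableEdge⇒arc (proj₂ (t a)))
    t≡arc : ∀ a → proj₁ (t a) ≡ arc (toℕ (J a))
    t≡arc a = proj₂ (stableEdge⇒arc (proj₂ (t a)))
    next-corner∈ : ∀ j → corner (next j) ∈ arc (toℕ j)
    next-corner∈ j = subst (_∈ arc (toℕ j)) (sym (corner-next≡end j)) (end∈arc (toℕ j))
    arcs-disjoint : ∀ a b → a ≢ b → Disjoint (arc (toℕ (J a))) (arc (toℕ (J b)))
    arcs-disjoint a b a≢b = subst₂ Disjoint (t≡arc a) (t≡arc b) (disjoint a b a≢b)

  KG-χ≡1 : KGChromaticNumberIs r s F 1
  KG-χ≡1 = ((λ _ → zero) , λ t t-edge _ → kg-edgeless t t-edge) , no-smaller-colouring
    where
    no-smaller-colouring : ∀ k → k < 1 → ¬ KGColourable r s F k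
    no-smaller-colouring zero    _         (c , _) with c arc₀
    ... | ()
    no-smaller-colouring (suc k) (s≤s ()) _

  even-corner : Fin r → Fin n
  even-corner a = ((toℕ a + toℕ a) * g) mod n

  S₀ : Subset n
  S₀ = image even-corner

  ∣S₀∣≤r : ∣ S₀ ∣ ≤ r
  ∣S₀∣≤r = ∣image∣≤ even-corner

  even-corner∈S₀ : ∀ a → a < r → ((a + a) * g) mod n ∈ S₀
  even-corner∈S₀ a a<r =
    subst (λ x → ((x + x) * g) mod n ∈ S₀) (toℕ-fromℕ< a<r) (∈-image⁺ even-corner (fromℕ< a<r))

  arc-meets-S₀ : ∀ j → j < m → ∃ λ v → v ∈ arc j × v ∈ S₀
  arc-meets-S₀ j j<m with even-or-odd j
  ... | a , inj₁ refl =
    _ , start∈arc (a + a) , even-corner∈S₀ a (a+a<b+b⇒a<b (<-≤-trans j<m (<⇒≤ m<r+r)))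
  ... | a , inj₂ refl =
    _ , end∈arc (suc (a + a)) ,
    subst (λ x → (x * g) mod n ∈ S₀) (cong suc (+-suc a a))
      (even-corner∈S₀ (suc a) (s≤s (a+a<b+b⇒a<b (s≤s⁻¹ j<m))))

  S₀-colouring : InducedColourable s F S₀
  S₀-colouring = (λ v _ → toℕ v mod s) , proper
    where
    proper : ∀ e → T (edge F e) → (avoid : ∀ v → v ∈ e → v ∉ S₀) →
      ¬ ∃ λ a → ∀ v (v∈e : v ∈ e) → toℕ v mod s ≡ a
    proper e e∈F avoid (a , mono) with toWitness {a? = isEdge? e} e∈F
    ... | inj₁ (u , w , u≢w , unstable , refl) =
      unstable (∣distance⇒stablePair s∣n u≢w (m%d≡n%d⇒d∣∣m-n∣ s same-residue))
      where
      same-colour : toℕ u mod s ≡ toℕ w mod s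
      same-colour = trans (mono u (x∈p∪q⁺ (inj₁ (x∈⁅x⁆ u)))) (sym (mono w (x∈p∪q⁺ (inj₂ (x∈⁅x⁆ w)))))
      same-residue : toℕ u % s ≡ toℕ w % s
      same-residue = trans (sym (toℕ-mod (toℕ u) s)) (trans (cong toℕ same-colour) (toℕ-mod (toℕ w) s))
    ... | inj₂ (j , refl) with arc-meets-S₀ (toℕ j) (toℕ<n j)
    ...   | v , v∈arc , v∈S₀ = avoid v v∈arc v∈S₀

  module LowerBound (S : Subset n) (S-colouring : InducedColourable s F S) where

    -- Proofs of v ∉ S need not be equal; recomputing one from v ∈? S makes the colour of v
    -- independent of the proof supplied.
    colour : (v : Fin n) → .(v ∉ S) → Fin s
    colour v v∉S = proj₁ S-colouring v (recompute (¬? (v ∈? S)) v∉S)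

    colour-cong : ∀ {u w} → u ≡ w → .(u∉S : u ∉ S) .(w∉S : w ∉ S) → colour u u∉S ≡ colour w w∉S
    colour-cong refl _ _ = refl

    edge-not-monochromatic : ∀ {e} → T (edge F e) → (avoid : ∀ v → v ∈ e → v ∉ S) →
      ∀ a → ¬ (∀ v (v∈e : v ∈ e) → colour v (avoid v v∈e) ≡ a)
    edge-not-monochromatic {e} e∈F avoid a mono =
      proj₂ S-colouring e e∈F (λ v v∈e → recompute (¬? (v ∈? S)) (avoid v v∈e)) (a , mono)

    unstable-colours-differ : ∀ {u w} → u ≢ w → ¬ StablePair s u w →
      (u∉S : u ∉ S) (w∉S : w ∉ S) → colour u u∉S ≢ colour w w∉S
    unstable-colours-differ {u} {w} u≢w unstable u∉S w∉S same =
      edge-not-monochromatic (fromWitness (inj₁ (u , w , u≢w , unstable , refl))) avoid (colour u u∉S) mono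
      where
      endpoint : ∀ {v} → v ∈ ⁅ u ⁆ ∪ ⁅ w ⁆ → v ≡ u ⊎ v ≡ w
      endpoint v∈ with x∈p∪q⁻ ⁅ u ⁆ ⁅ w ⁆ v∈
      ... | inj₁ v∈⁅u⁆ = inj₁ (x∈⁅y⁆⇒x≡y u v∈⁅u⁆)
      ... | inj₂ v∈⁅w⁆ = inj₂ (x∈⁅y⁆⇒x≡y w v∈⁅w⁆)
      avoid : ∀ v → v ∈ ⁅ u ⁆ ∪ ⁅ w ⁆ → v ∉ S
      avoid v v∈ with endpoint v∈
      ... | inj₁ refl = u∉S
      ... | inj₂ refl = w∉S
      mono : ∀ v (v∈ : v ∈ ⁅ u ⁆ ∪ ⁅ w ⁆) → colour v (avoid v v∈) ≡ colour u u∉S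
      mono v v∈ with endpoint v∈
      ... | inj₁ refl = refl
      ... | inj₂ refl = sym same

    -- With s colours, two of the s + 1 window points agree, and only the two ends may.
    colour-period : ∀ p → s + p ≤ n → (avoid : ∀ i → i ≤ s → (i + p) mod n ∉ S) →
      colour (p mod n) (avoid 0 z≤n) ≡ colour ((s + p) mod n) (avoid s ≤-refl)
    colour-period p s+p≤n avoid = extremes-agree (pigeonhole (n<1+n s) window-colour)
      where
      window : Fin (suc s) → Fin n
      window i = (toℕ i + p) mod n
      window-avoids : ∀ i → window i ∉ S
      window-avoids i = avoid (toℕ i) (toℕ≤pred[n] i)
      window-colour : Fin (suc s) → Fin s
      window-colour i = colour (window i) (window-avoids i)
      shifted≤n : ∀ (k : Fin (suc s)) → toℕ k + p ≤ n
      shifted≤n k = ≤-trans (+-monoˡ-≤ p (toℕ≤pred[n] k)) s+p≤n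
      shift-distance : ∀ (i k : Fin (suc s)) → (toℕ k + p) ∸ (toℕ i + p) ≡ toℕ k ∸ toℕ i
      shift-distance i k =
        trans (cong₂ _∸_ (+-comm (toℕ k) p) (+-comm (toℕ i) p)) ([m+n]∸[m+o]≡n∸o p (toℕ k) (toℕ i))
      extremes-agree : (∃ λ i → ∃ λ k → i Fin.< k × window-colour i ≡ window-colour k) →
        colour (p mod n) (avoid 0 z≤n) ≡ colour ((s + p) mod n) (avoid s ≤-refl)
      extremes-agree (i , k , i<k , same) with toℕ k ∸ toℕ i <? s
      ... | yes close
        with close⇒unstable s≤n (+-monoˡ-< p i<k) (shifted≤n k)
               (subst (_< s) (sym (shift-distance i k)) close)
      ...   | window-i≢k , unstable =
        contradiction same (unstable-colours-differ window-i≢k unstable (window-avoids i) (window-avoids k))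
      extremes-agree (i , k , i<k , same) | no far with far-apart⇒extremes i<k (toℕ≤pred[n] k) (≮⇒≥ far)
      ... | i≡0 , k≡s =
        trans (colour-cong (cong (λ x → (x + p) mod n) (sym i≡0)) (avoid 0 z≤n) (window-avoids i))
          (trans same (colour-cong (cong (λ x → (x + p) mod n) k≡s) (window-avoids k) (avoid s ≤-refl)))

    arc-monochromatic : ∀ j → suc j * g ≤ n → (avoid : ∀ x → x ≤ g → (x + j * g) mod n ∉ S) →
      ∀ {v} (v∉S : v ∉ S) → v ∈ arc j → colour v v∉S ≡ colour ((j * g) mod n) (avoid 0 z≤n)
    arc-monochromatic j arc≤n avoid v∉S v∈arc with ∈-image⁻ (arc-point j) v∈arc
    ... | t , refl = chain (toℕ t) (toℕ≤pred[n] t) v∉S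
      where
      chain : ∀ t → t ≤ L → .(v∉S : (t * s + j * g) mod n ∉ S) →
        colour ((t * s + j * g) mod n) v∉S ≡ colour ((j * g) mod n) (avoid 0 z≤n)
      chain zero    _     _ = refl
      chain (suc t) 1+t≤L v∉S =
        trans (colour-cong (cong (_mod n) (+-assoc s (t * s) (j * g))) v∉S (avoid′ s ≤-refl))
          (trans (sym (colour-period (t * s + j * g) period≤n avoid′))
            (chain t (≤-trans (n≤1+n t) 1+t≤L) (avoid′ 0 z≤n)))
        where
        1+t*s≤g : suc t * s ≤ g
        1+t*s≤g = *-monoˡ-≤ s 1+t≤L
        avoid′ : ∀ i → i ≤ s → (i + (t * s + j * g)) mod n ∉ S
        avoid′ i i≤s = subst (λ x → x mod n ∉ S) (+-assoc i (t * s) (j * g))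
                         (avoid (i + t * s) (≤-trans (+-monoˡ-≤ (t * s) i≤s) 1+t*s≤g))
        period≤n : s + (t * s + j * g) ≤ n
        period≤n = ≤-trans (≤-reflexive (sym (+-assoc s (t * s) (j * g))))
                     (≤-trans (+-monoˡ-≤ (j * g) 1+t*s≤g) arc≤n)

    arc-meets-S : ∀ j → j < m → ∃ λ (x : Fin (suc g)) → (toℕ x + j * g) mod n ∈ S
    arc-meets-S j j<m with any? (λ (x : Fin (suc g)) → (toℕ x + j * g) mod n ∈? S)
    ... | yes hit = hit
    ... | no miss =
      contradiction (λ v v∈arc → arc-monochromatic j (*-monoˡ-≤ g j<m) avoid (arc-avoids v v∈arc) v∈arc)
        (edge-not-monochromatic arc-j∈F arc-avoids (colour ((j * g) mod n) (avoid 0 z≤n)))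
      where
      avoid : ∀ x → x ≤ g → (x + j * g) mod n ∉ S
      avoid x x≤g x∈S =
        miss (fromℕ< (s≤s x≤g) , subst (λ y → (y + j * g) mod n ∈ S) (sym (toℕ-fromℕ< (s≤s x≤g))) x∈S)
      arc-avoids : ∀ v → v ∈ arc j → v ∉ S
      arc-avoids v v∈arc with ∈-image⁻ (arc-point j) v∈arc
      ... | t , refl = avoid (toℕ t * s) (offset≤g t)
      arc-j∈F : T (edge F (arc j))
      arc-j∈F = subst (λ i → T (edge F (arc i))) (toℕ-fromℕ< j<m) (arc∈F (fromℕ< j<m))

    hit : ∀ j → j < m → ℕ
    hit j j<m = toℕ (proj₁ (arc-meets-S j j<m)) + j * g

    hit∈S : ∀ j (j<m : j < m) → hit j j<m mod n ∈ S
    hit∈S j j<m = proj₂ (arc-meets-S j j<m)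

    hit-cong : ∀ {i j} (i<m : i < m) (j<m : j < m) → i ≡ j → hit i i<m ≡ hit j j<m
    hit-cong i<m j<m refl = cong (hit _) (<-irrelevant i<m j<m)

    hit≥ : ∀ j (j<m : j < m) → j * g ≤ hit j j<m
    hit≥ j j<m = m≤n+m (j * g) _

    hit≤ : ∀ j (j<m : j < m) → hit j j<m ≤ suc j * g
    hit≤ j j<m = +-monoˡ-≤ (j * g) (toℕ≤pred[n] (proj₁ (arc-meets-S j j<m)))

    hit-gap : ∀ {i j} (i<m : i < m) (j<m : j < m) → suc i < j → hit i i<m < hit j j<m
    hit-gap {i} {j} i<m j<m 1+i<j = <-≤-trans (≤-<-trans (hit≤ i i<m) (*-monoˡ-< g 1+i<j)) (hit≥ j j<m)

    hit<n : ∀ j (j<m : j < m) → suc j < m → hit j j<m < n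
    hit<n j j<m 1+j<m = ≤-<-trans (hit≤ j j<m) (*-monoˡ-< g 1+j<m)

    last<m : q + q < m
    last<m = n<1+n (q + q)

    even-hits-bound : hit (q + q) last<m < n → r ≤ ∣ S ∣
    even-hits-bound last<n =
      increasing-positions⇒≤∣∣ even-hit (λ a<b → hit-gap _ _ (a<b⇒1+a+a<b+b a<b)) even-hit<n
        (λ a → hit∈S _ (even-index<m a))
      where
      even-index<m : ∀ (a : Fin r) → toℕ a + toℕ a < m
      even-index<m a = s≤s (+-mono-≤ (toℕ≤pred[n] a) (toℕ≤pred[n] a))
      even-hit : Fin r → ℕ
      even-hit a = hit (toℕ a + toℕ a) (even-index<m a)
      even-hit<n : ∀ a → even-hit a < n
      even-hit<n a with m≤n⇒m<n∨m≡n (toℕ≤pred[n] a)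
      ... | inj₁ a<q = hit<n _ _ (s≤s (+-mono-< a<q a<q))
      ... | inj₂ a≡q = subst (_< n) (hit-cong last<m _ (cong₂ _+_ (sym a≡q) (sym a≡q))) last<n

    odd-hits-bound : hit (q + q) last<m ≡ n → r ≤ ∣ S ∣
    odd-hits-bound last≡n = increasing-positions⇒≤∣∣ odd-hit odd-hit-mono odd-hit<n odd-hit∈S
      where
      odd-index<m : ∀ (a : Fin q) → suc (toℕ a + toℕ a) < m
      odd-index<m a = s≤s (+-mono-< (toℕ<n a) (toℕ<n a))
      odd-hit : Fin r → ℕ
      odd-hit zero    = 0
      odd-hit (suc a) = hit (suc (toℕ a + toℕ a)) (odd-index<m a)
      odd-hit-mono : odd-hit Preserves Fin._<_ ⟶ _<_
      odd-hit-mono {zero}  {suc b} _         =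
        <-≤-trans (>-nonZero⁻¹ g) (≤-trans (m≤n*m g (suc (toℕ b + toℕ b))) (hit≥ _ (odd-index<m b)))
      odd-hit-mono {suc a} {suc b} (s≤s a<b) = hit-gap _ _ (s≤s (a<b⇒1+a+a<b+b a<b))
      odd-hit<n : ∀ a → odd-hit a < n
      odd-hit<n zero    = >-nonZero⁻¹ n
      odd-hit<n (suc a) = hit<n _ _ (s≤s (a<b⇒1+a+a<b+b (toℕ<n a)))
      odd-hit∈S : ∀ a → odd-hit a mod n ∈ S
      odd-hit∈S zero    =
        subst (_∈ S) (trans (cong (_mod n) last≡n) (n-mod-n≡0-mod-n n)) (hit∈S _ last<m)
      odd-hit∈S (suc a) = hit∈S _ (odd-index<m a)

    -- If the point of S in the last interval is not vertex 0, the even intervals supply r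
    -- distinct points of S; otherwise vertex 0 and the odd intervals do.
    r≤∣S∣ : r ≤ ∣ S ∣
    r≤∣S∣ with m≤n⇒m<n∨m≡n (hit≤ (q + q) last<m)
    ... | inj₁ last<n = even-hits-bound last<n
    ... | inj₂ last≡n = odd-hits-bound last≡n

  open LowerBound public using (r≤∣S∣)

theorem1p15 : (r s l : ℕ) → (hr : 2 ≤ r) → 2 ≤ s → 2 ≤ l →
    ∃ λ (n : ℕ) → l < n × Σ (Hypergraph n) λ F →
      KGChromaticNumberIs r s F 1 ×
      ∃ λ (d : ℕ) → ColourabilityDefectIs s F d ×
        2 ≤ ⌈_/_⌉ d (r ∸ 1) {{pred-nonZero r hr}}
theorem1p15 (suc q@(suc _)) s@(suc _) l (s≤s (s≤s z≤n)) (s≤s _) _ =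
  n , L≤n , F , KG-χ≡1 ,
  ∣ S₀ ∣ , ((S₀ , refl , S₀-colouring) , λ S S-colouring → ≤-trans ∣S₀∣≤r (r≤∣S∣ S S-colouring)) ,
  2≤⌈m/n⌉ q (r≤∣S∣ S₀ S₀-colouring)
  where open Construction s (suc l) q
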